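{- Let $k\ge2$ and $\ell,m\ge0$ be integers. Then \[ \mathcal{A}_{\ell,m}^{(k)}=\bigsqcup_{\substack{\mathcal{I},\mathcal{J}\subseteq\Lambda_k\\ \#\mathcal{I}=\ell,\ \#\mathcal{J}=m,\ \mathcal{I}\cap\mathcal{J}=\varnothing}}\mathcal{B}_{\mathcal{I},\mathcal{J}}^{(k)}, \] a disjoint union.
   Context: A positive integer $n$ is $k$-full if $p^k\mid n$ for every prime $p\mid n$. $\Lambda_k$ denotes the set of real numbers $(b_1^{k+1}b_2^{k+2}\cdots b_{k-1}^{2k-1})^{1/k}$ where $b_1,\dots,b_{k-1}$ are positive integers with $b_1\cdots b_{k-1}\ge2$ and $b_1\cdots b_{k-1}$ squarefree. For nonempty $\mathcal{I}\subseteq\Lambda_k$, $\mathcal{S}_{\mathcal{I}}:=\{a^k\lambda^k : a\in\mathbb{Z}_{\ge1},\ \lambda\in\mathcal{I}\}$, $\mathcal{S}_\varnothing:=\varnothing$, and $\mathcal{S}_k:=\mathcal{S}_{\Lambda_k}$ (the $k$-full integers that are not perfect $k$th powers). $\mathcal{A}_{\ell,m}^{(k)}:=\{n\in\mathbb{Z}_{\ge1} : \#((n^k,(n+1)^k)\cap\mathcal{S}_k)=\ell,\ \#(((n+1)^k,(n+2)^k)\cap\mathcal{S}_k)=m\}$. For finite disjoint $\mathcal{I},\mathcal{J}\subseteq\Lambda_k$, $\mathcal{B}_{\mathcal{I},\mathcal{J}}^{(k)}:=\{n\in\mathbb{Z}_{\ge1} : \#((n^k,(n+1)^k)\cap\mathcal{S}_{\mathcal{I}})=\#\mathcal{I},\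 \#(((n+1)^k,(n+2)^k)\cap\mathcal{S}_{\mathcal{J}})=\#\mathcal{J},\ (n^k,(n+2)^k)\cap\mathcal{S}_{\Lambda_k\setminus(\mathcal{I}\cup\mathcal{J})}=\varnothing\}$. -}

module Defs where

open import Data.Nat using (ℕ; suc; _+_; _*_; _∸_; _^_; _≤_; _<_)
open import Data.Nat.Divisibility using (_∣_)
open import Data.Nat.Primality using (Prime)
open import Data.Fin using (Fin; toℕ; zero) renaming (suc to fsuc)
open import Data.List using (List; length)
open import Data.List.Membership.Propositional using (_∈_; _∉_)
open import Data.List.Relation.Unary.All using (All)
open import Data.List.Relation.Unary.Unique.Propositional using (Unique)
open import Data.Product using (Σ; ∃; _×_)
open import Relation.Binary.PropositionalEquality using (_≡_)
open import Relation.Nullary using (¬_)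

∏ : (n : ℕ) → (Fin n → ℕ) → ℕ
∏ ℕ.zero f = 1
∏ (suc n) f = f zero * ∏ n (λ i → f (fsuc i))

Squarefree : ℕ → Set
Squarefree n = (p : ℕ) → Prime p → ¬ (p * p ∣ n)

HasCard : (ℕ → Set) → ℕ → Set
HasCard X c = Σ (List ℕ) λ xs → Unique xs × length xs ≡ c × ((x : ℕ) → (x ∈ xs → X x) × (X x → x ∈ xs))

-- Λ_k encoded through λ^k: L is (the k-th power of) an element of Λ_k iff
-- L = b_1^{k+1} b_2^{k+2} ... b_{k-1}^{2k-1} with b_i ≥ 1, b_1⋯b_{k-1} ≥ 2 squarefree.
-- (b is indexed by i : Fin (k ∸ 1); b i stands for b_{i+1}, exponent k + (i+1).)
Λ : ℕ → ℕ → Set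
Λ k L = Σ (Fin (k ∸ 1) → ℕ) λ b →
          ((i : Fin (k ∸ 1)) → 1 ≤ b i)
        × 2 ≤ ∏ (k ∸ 1) b
        × Squarefree (∏ (k ∸ 1) b)
        × L ≡ ∏ (k ∸ 1) (λ i → b i ^ (k + suc (toℕ i)))

S : ℕ → (ℕ → Set) → ℕ → Set
S k P x = ∃ λ a → ∃ λ L → 1 ≤ a × P L × x ≡ a ^ k * L

Sk : ℕ → ℕ → Set
Sk k = S k (Λ k)

Between : ℕ → ℕ → (ℕ → Set) → ℕ → Set
Between u v X x = u < x × x < v × X x

A : ℕ → ℕ → ℕ → ℕ → Set
A k ℓ m n = 1 ≤ n
          × HasCard (Between (n ^ k) (suc n ^ k) (Sk k)) ℓ
          × HasCard (Between (suc n ^ k) (suc (suc n) ^ k) (Sk k)) m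

FinSubΛ : ℕ → List ℕ → Set
FinSubΛ k I = Unique I × All (Λ k) I

Mem : List ℕ → ℕ → Set
Mem I L = L ∈ I

Rest : ℕ → List ℕ → List ℕ → ℕ → Set
Rest k I J L = Λ k L × L ∉ I × L ∉ J

B : ℕ → List ℕ → List ℕ → ℕ → Set
B k I J n = 1 ≤ n
          × HasCard (Between (n ^ k) (suc n ^ k) (S k (Mem I))) (length I)
          × HasCard (Between (suc n ^ k) (suc (suc n) ^ k) (S k (Mem J))) (length J)
          × ((x : ℕ) → ¬ Between (n ^ k) (suc (suc n) ^ k) (S k (Rest k I J)) x)

-- index set of the union: I, J ⊆ Λ_k finite, #I = ℓ, #J = m, I ∩ J = ∅
Admissible : ℕ → ℕ → ℕ → List ℕ → List ℕ → Set
Admissible k ℓ m I J = FinSubΛ k I × FinSubΛ k J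
                     × length I ≡ ℓ × length J ≡ m
                     × ((x : ℕ) → x ∈ I → x ∉ J)

SameSet : List ℕ → List ℕ → Set
SameSet I I' = (x : ℕ) → (x ∈ I → x ∈ I') × (x ∈ I' → x ∈ I)

-- Write λ ^ k = ∏ b i ^ (k + i) with ∏ b i squarefree.  For a prime p, the p-adic valuation of
-- a ^ k * λ ^ k is k v_p(a) plus 0 or k + i, so modulo k it determines the exponent of p in λ ^ k;
-- hence every element of S_k is a ^ k λ ^ k for a unique λ, and never a perfect k-th power.
-- Since λ ^ k > 2 ^ k, the numbers a ^ k λ ^ k and (a + 1) ^ k λ ^ k cannot both lie in
-- (n ^ k, (n + 2) ^ k).  So the elements of S_k in (n ^ k, (n + 1) ^ k) and in ((n + 1) ^ k, (n + 2) ^ k)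
-- correspond bijectively to their λ's, which form two disjoint sets I and J, and n lies in B_{I,J}
-- exactly for this pair.

module Submission where

open import Defs
open import Data.Empty using (⊥; ⊥-elim)
open import Data.Fin using (Fin; toℕ) renaming (zero to fzero; suc to fsuc)
open import Data.Fin.Properties using (toℕ<n)
open import Data.List using (List; []; _∷_; length)
open import Data.List.Membership.Propositional using (_∈_; _∉_; _─_)
open import Data.List.Properties using (length-removeAt′)
open import Data.List.Relation.Binary.Subset.Propositional using (_⊆_)
open import Data.List.Relation.Unary.All as All using (All; []; _∷_)
open import Data.List.Relation.Unary.AllPairs using ([]; _∷_)
open import Data.List.Relation.Unary.Any using (here; there; index; any?)
open import Data.List.Relation.Unary.Unique.Propositional using (Unique)
open import Data.Nat using (ℕ; zero; suc; _+_; _*_; _∸_; _^_; _≤_; _<_; z≤n; s≤s; NonZero; _≟_; _≤?_;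
                            >-nonZero; ≢-nonZero; nonTrivial⇒n>1)
open import Data.List.Membership.DecPropositional _≟_ using (_∈?_)
open import Data.Nat.DivMod using (_%_; [m+kn]%n≡m%n; m<n⇒m%n≡m)
open import Data.Nat.Divisibility using (_∣_; divides; _∣?_; ∣-trans; ∣1⇒≡1; m∣m*n; n∣m*n; _∣0; *-monoʳ-∣)
open import Data.Nat.Induction using (<-wellFounded)
open import Data.Nat.Primality using (Prime; euclidsLemma; ¬prime[1]; prime[2]; prime⇒nonZero; prime⇒nonTrivial)
open import Data.Nat.Primality.Factorisation using (factorise)
open import Data.Nat.Properties
open import Data.Product using (Σ; ∃; ∃₂; _×_; _,_; proj₁; proj₂)
open import Data.Sum using (_⊎_; inj₁; inj₂; swap)
open import Data.Vec.Functional as Vector using (head; tail; zipWith)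
open import Function using (_∘_)
open import Function.Bundles using (_⇔_; mk⇔)
open import Induction.WellFounded using (Acc; acc)
open import Relation.Binary.Definitions using (DecidableEquality; tri<; tri≈; tri>)
open import Relation.Binary.PropositionalEquality
open import Relation.Nullary using (¬_; yes; no)

open import Algebra.Properties.CommutativeSemigroup *-commutativeSemigroup as *-Props using ()

^-distribʳ-* : ∀ m n o → (m * n) ^ o ≡ m ^ o * n ^ o
^-distribʳ-* m n zero    = refl
^-distribʳ-* m n (suc o) =
  trans (cong ((m * n) *_) (^-distribʳ-* m n o)) (*-Props.interchange m n (m ^ o) (n ^ o))

residue-injective : ∀ k .{{_ : NonZero k}} α β {r s} → r < k → s < k → α * k + r ≡ β * k + s → r ≡ s
residue-injective k α β {r} {s} r<k s<k eq = begin
  r               ≡⟨ m<n⇒m%n≡m r<k ⟨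
  r % k           ≡⟨ [m+kn]%n≡m%n r α k ⟨
  (r + α * k) % k ≡⟨ cong (_% k) (trans (+-comm r (α * k)) (trans eq (+-comm (β * k) s))) ⟩
  (s + β * k) % k ≡⟨ [m+kn]%n≡m%n s β k ⟩
  s % k           ≡⟨ m<n⇒m%n≡m s<k ⟩
  s               ∎
  where open ≡-Reasoning

p-adic-regroup : ∀ k p α a₀ E L → (p ^ α * a₀) ^ k * (p ^ E * L) ≡ p ^ (α * k + E) * (a₀ ^ k * L)
p-adic-regroup k p α a₀ E L = begin
  (p ^ α * a₀) ^ k * (p ^ E * L)         ≡⟨ cong (_* (p ^ E * L)) (^-distribʳ-* (p ^ α) a₀ k) ⟩
  ((p ^ α) ^ k * a₀ ^ k) * (p ^ E * L)   ≡⟨ cong (λ x → (x * a₀ ^ k) * (p ^ E * L)) (^-*-assoc p α k) ⟩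
  (p ^ (α * k) * a₀ ^ k) * (p ^ E * L)   ≡⟨ *-Props.interchange (p ^ (α * k)) (a₀ ^ k) (p ^ E) L ⟩
  (p ^ (α * k) * p ^ E) * (a₀ ^ k * L)   ≡⟨ cong (_* (a₀ ^ k * L)) (^-distribˡ-+-* p (α * k) E) ⟨
  p ^ (α * k + E) * (a₀ ^ k * L)         ∎
  where open ≡-Reasoning

module _ {p : ℕ} (p-prime : Prime p) where

  private instance
    p≢0 : NonZero p
    p≢0 = prime⇒nonZero p-prime

  prime∤1 : ¬ p ∣ 1
  prime∤1 p∣1 = ¬prime[1] (subst Prime (∣1⇒≡1 p∣1) p-prime)

  prime∤* : ∀ {m n} → ¬ p ∣ m → ¬ p ∣ n → ¬ p ∣ m * n
  prime∤* p∤m p∤n p∣mn with euclidsLemma _ _ p-prime p∣mn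
  ... | inj₁ p∣m = p∤m p∣m
  ... | inj₂ p∣n = p∤n p∣n

  prime∣^⇒∣ : ∀ m n → p ∣ m ^ n → p ∣ m
  prime∣^⇒∣ m zero    p∣1 = ⊥-elim (prime∤1 p∣1)
  prime∣^⇒∣ m (suc n) p∣m*mⁿ with euclidsLemma m (m ^ n) p-prime p∣m*mⁿ
  ... | inj₁ p∣m  = p∣m
  ... | inj₂ p∣mⁿ = prime∣^⇒∣ m n p∣mⁿ

  prime∤^ : ∀ {m} n → ¬ p ∣ m → ¬ p ∣ m ^ n
  prime∤^ n p∤m p∣mⁿ = p∤m (prime∣^⇒∣ _ n p∣mⁿ)

  p^*-injective : ∀ v w {r s} → ¬ p ∣ r → ¬ p ∣ s → p ^ v * r ≡ p ^ w * s → v ≡ w × r ≡ s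
  p^*-injective zero    zero    _   _   eq = refl , trans (sym (*-identityˡ _)) (trans eq (*-identityˡ _))
  p^*-injective zero    (suc w) p∤r _   eq =
    ⊥-elim (p∤r (subst (p ∣_) (sym (trans (sym (*-identityˡ _)) (trans eq (*-assoc p _ _)))) (m∣m*n _)))
  p^*-injective (suc v) zero    _   p∤s eq =
    ⊥-elim (p∤s (subst (p ∣_) (trans (sym (*-assoc p _ _)) (trans eq (*-identityˡ _))) (m∣m*n _)))
  p^*-injective (suc v) (suc w) p∤r p∤s eq
    with v≡w , r≡s ← p^*-injective v w p∤r p∤s
           (*-cancelˡ-≡ _ _ p (trans (sym (*-assoc p _ _)) (trans eq (*-assoc p _ _))))
    = cong suc v≡w , r≡s

  p-adic-split : ∀ a → a ≢ 0 → ∃₂ λ α a₀ → a ≡ p ^ α * a₀ × ¬ p ∣ a₀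
  p-adic-split a a≢0 = split a a≢0 (<-wellFounded a)
    where
    split : ∀ a → a ≢ 0 → Acc _<_ a → ∃₂ λ α a₀ → a ≡ p ^ α * a₀ × ¬ p ∣ a₀
    split a a≢0 (acc rec) with p ∣? a
    ... | no p∤a = 0 , a , sym (*-identityˡ a) , p∤a
    ... | yes (divides q a≡q*p) with split q q≢0 (rec q<a)
      where
      q≢0 : q ≢ 0
      q≢0 refl = a≢0 a≡q*p
      q<a : q < a
      q<a = subst (q <_) (sym a≡q*p) (m<m*n q p {{≢-nonZero q≢0}} (nonTrivial⇒n>1 p {{prime⇒nonTrivial p-prime}}))
    ...   | α , a₀ , q≡ , p∤a₀ =
      suc α , a₀ , trans a≡q*p (trans (*-comm q p) (trans (cong (p *_) q≡) (sym (*-assoc p (p ^ α) a₀)))) , p∤a₀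

  prime∣∏^⇒∣∏ : ∀ K (b e : Fin K → ℕ) → p ∣ ∏ K (zipWith _^_ b e) → p ∣ ∏ K b
  prime∣∏^⇒∣∏ zero    b e p∣1 = p∣1
  prime∣∏^⇒∣∏ (suc K) b e p∣∏
    with euclidsLemma (head b ^ head e) (∏ K (zipWith _^_ (tail b) (tail e))) p-prime p∣∏
  ... | inj₁ p∣b₀^e₀ = ∣-trans (prime∣^⇒∣ (head b) (head e) p∣b₀^e₀) (m∣m*n (∏ K (tail b)))
  ... | inj₂ p∣∏tail = ∣-trans (prime∣∏^⇒∣∏ K (tail b) (tail e) p∣∏tail) (n∣m*n (head b))

  -- p divides some b j; c is b with that entry divided by p
  prime∣∏-extract : ∀ K (b e : Fin K → ℕ) → p ∣ ∏ K b →
    Σ (Fin K) λ j → Σ (Fin K → ℕ) λ c →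
      ∏ K b ≡ p * ∏ K c × ∏ K (zipWith _^_ b e) ≡ p ^ e j * ∏ K (zipWith _^_ c e)
  prime∣∏-extract zero    b e p∣1 = ⊥-elim (prime∤1 p∣1)
  prime∣∏-extract (suc K) b e p∣∏ with euclidsLemma (head b) (∏ K (tail b)) p-prime p∣∏
  ... | inj₁ (divides q b₀≡q*p) = fzero , q Vector.∷ tail b , ∏-eq , ∏^-eq
    where
    b₀≡p*q : head b ≡ p * q
    b₀≡p*q = trans b₀≡q*p (*-comm q p)
    ∏-eq : head b * ∏ K (tail b) ≡ p * (q * ∏ K (tail b))
    ∏-eq = trans (cong (_* ∏ K (tail b)) b₀≡p*q) (*-assoc p q _)
    ∏^-eq : head b ^ head e * ∏ K (zipWith _^_ (tail b) (tail e))
          ≡ p ^ head e * (q ^ head e * ∏ K (zipWith _^_ (tail b) (tail e)))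
    ∏^-eq = trans (cong (λ x → x ^ head e * R) b₀≡p*q)
                  (trans (cong (_* R) (^-distribʳ-* p q (head e))) (*-assoc (p ^ head e) (q ^ head e) R))
      where R = ∏ K (zipWith _^_ (tail b) (tail e))
  ... | inj₂ p∣∏tail with j , c , ∏-eq , ∏^-eq ← prime∣∏-extract K (tail b) (tail e) p∣∏tail =
    fsuc j , head b Vector.∷ c ,
    trans (cong (head b *_) ∏-eq) (*-Props.x∙yz≈y∙xz (head b) p (∏ K c)) ,
    trans (cong (head b ^ head e *_) ∏^-eq)
          (*-Props.x∙yz≈y∙xz (head b ^ head e) (p ^ tail e j) (∏ K (zipWith _^_ c (tail e))))

  ^*-p-adic : ∀ k {a N E L} → a ≢ 0 → N ≡ p ^ E * L → ¬ p ∣ L →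
    ∃₂ λ α a₀ → a₀ ≢ 0 × ¬ p ∣ a₀ ^ k * L × a ^ k * N ≡ p ^ (α * k + E) * (a₀ ^ k * L)
  ^*-p-adic k {a} {E = E} {L} a≢0 N≡ p∤L with α , a₀ , a≡ , p∤a₀ ← p-adic-split a a≢0 =
    α , a₀ , (λ { refl → p∤a₀ (p ∣0) }) , prime∤* (prime∤^ k p∤a₀) p∤L ,
    trans (cong₂ (λ x y → x ^ k * y) a≡ N≡) (p-adic-regroup k p α a₀ E L)

∏≡1⇒∏^≡1 : ∀ K (b e : Fin K → ℕ) → ∏ K b ≡ 1 → ∏ K (zipWith _^_ b e) ≡ 1
∏≡1⇒∏^≡1 zero    b e _    = refl
∏≡1⇒∏^≡1 (suc K) b e ∏≡1 =
  cong₂ _*_ (trans (cong (_^ head e) (m*n≡1⇒m≡1 (head b) (∏ K (tail b)) ∏≡1)) (^-zeroˡ (head e)))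
            (∏≡1⇒∏^≡1 K (tail b) (tail e) (m*n≡1⇒n≡1 (head b) (∏ K (tail b)) ∏≡1))

∏^≤∏^ : ∀ K (b e : Fin K → ℕ) m → (∀ i → 1 ≤ b i) → (∀ i → m ≤ e i) →
        ∏ K b ^ m ≤ ∏ K (zipWith _^_ b e)
∏^≤∏^ zero    b e m _   _   = ≤-reflexive (^-zeroˡ m)
∏^≤∏^ (suc K) b e m 1≤b m≤e = begin
  (head b * ∏ K (tail b)) ^ m          ≡⟨ ^-distribʳ-* (head b) (∏ K (tail b)) m ⟩
  head b ^ m * ∏ K (tail b) ^ m        ≤⟨ *-mono-≤ (^-monoʳ-≤ (head b) {{>-nonZero (1≤b fzero)}} (m≤e fzero))
                                                   (∏^≤∏^ K (tail b) (tail e) m (1≤b ∘ fsuc) (m≤e ∘ fsuc)) ⟩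
  ∏ (suc K) (zipWith _^_ b e)          ∎
  where open ≤-Reasoning

prime-factor : ∀ n → 2 ≤ n → ∃ λ p → Prime p × p ∣ n
prime-factor (suc zero) (s≤s ())
prime-factor n@(suc (suc _)) _ with factorise n
... | record { factors = [] ; isFactorisation = () }
... | record { factors = p ∷ _ ; isFactorisation = n≡∏ ; factorsPrime = p-prime ∷ _ } =
  p , p-prime , subst (p ∣_) (sym n≡∏) (m∣m*n _)

squarefree⇒≢0 : ∀ {n} → Squarefree n → n ≢ 0
squarefree⇒≢0 sq refl = sq 2 prime[2] (4 ∣0)

squarefree-∣ : ∀ {m n} → m ∣ n → Squarefree n → Squarefree m
squarefree-∣ m∣n sq p p-prime p²∣m = sq p p-prime (∣-trans p²∣m m∣n)

squarefree∧≢1⇒>1 : ∀ {n} → Squarefree n → n ≢ 1 → 1 < n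
squarefree∧≢1⇒>1 {0}           sq _   = ⊥-elim (squarefree⇒≢0 sq refl)
squarefree∧≢1⇒>1 {1}           _  n≢1 = ⊥-elim (n≢1 refl)
squarefree∧≢1⇒>1 {suc (suc _)} _  _   = s≤s (s≤s z≤n)

squarefree-p*⇒p∤ : ∀ {p n} → Prime p → Squarefree (p * n) → ¬ p ∣ n
squarefree-p*⇒p∤ {p} p-prime sq p∣n = sq p p-prime (*-monoʳ-∣ p p∣n)

-- With 0 < s i < k and ∏ b squarefree, every p-adic valuation of ⟦ b ⟧ is 0 or strictly between
-- k and 2k, so it is recovered from the valuation of a ^ k * ⟦ b ⟧ modulo k.
module KthPowerFreePart (k : ℕ) .{{_ : NonZero k}} (K : ℕ) (s : Fin K → ℕ)
                        (s≢0 : ∀ i → s i ≢ 0) (s<k : ∀ i → s i < k) where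

  exponent : Fin K → ℕ
  exponent i = k + s i

  ⟦_⟧ : (Fin K → ℕ) → ℕ
  ⟦ b ⟧ = ∏ K (zipWith _^_ b exponent)

  private
    shift : ∀ α i → α * k + exponent i ≡ suc α * k + s i
    shift α i = trans (sym (+-assoc (α * k) k (s i))) (cong (_+ s i) (+-comm (α * k) k))

  module _ {p : ℕ} (p-prime : Prime p) where

    private
      p∤⟦⟧ : ∀ {b} → ¬ p ∣ ∏ K b → ¬ p ∣ ⟦ b ⟧
      p∤⟦⟧ {b} p∤∏ p∣⟦⟧ = p∤∏ (prime∣∏^⇒∣∏ p-prime K b exponent p∣⟦⟧)

    prime-match : ∀ {a a' b b' j c} → Squarefree (∏ K b) → Squarefree (∏ K b') → a ≢ 0 → a' ≢ 0 →
      a ^ k * ⟦ b ⟧ ≡ a' ^ k * ⟦ b' ⟧ → ∏ K b ≡ p * ∏ K c → ⟦ b ⟧ ≡ p ^ exponent j * ⟦ c ⟧ →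
      Σ (Fin K → ℕ) λ c' → ∏ K b' ≡ p * ∏ K c' × ⟦ b' ⟧ ≡ p ^ exponent j * ⟦ c' ⟧ ×
        ∃₂ λ a₀ a₀' → a₀ ≢ 0 × a₀' ≢ 0 × a₀ ^ k * ⟦ c ⟧ ≡ a₀' ^ k * ⟦ c' ⟧
    prime-match {b' = b'} {j} sq sq' a≢0 a'≢0 eq ∏b≡ ⟦b⟧≡
      with α , a₀ , a₀≢0 , p∤lhs , lhs≡ ← ^*-p-adic p-prime k a≢0 ⟦b⟧≡
             (p∤⟦⟧ (squarefree-p*⇒p∤ p-prime (subst Squarefree ∏b≡ sq)))
         | p ∣? ∏ K b'
    ... | no p∤∏b'
      with α' , a₀' , _ , p∤rhs , rhs≡ ← ^*-p-adic p-prime k a'≢0 (sym (*-identityˡ ⟦ b' ⟧)) (p∤⟦⟧ p∤∏b')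
      with v≡v' , _ ← p^*-injective p-prime (α * k + exponent j) (α' * k + 0) p∤lhs p∤rhs
                        (trans (sym lhs≡) (trans eq rhs≡))
      = ⊥-elim (s≢0 j (residue-injective k (suc α) α' (s<k j) (≤-<-trans z≤n (s<k j))
                                           (trans (sym (shift α j)) v≡v')))
    ... | yes p∣∏b'
      with j' , c' , ∏b'≡ , ⟦b'⟧≡ ← prime∣∏-extract p-prime K b' exponent p∣∏b'
      with α' , a₀' , a₀'≢0 , p∤rhs , rhs≡ ← ^*-p-adic p-prime k a'≢0 ⟦b'⟧≡
             (p∤⟦⟧ (squarefree-p*⇒p∤ p-prime (subst Squarefree ∏b'≡ sq')))
      with v≡v' , cofactors≡ ← p^*-injective p-prime (α * k + exponent j) (α' * k + exponent j')
                                 p∤lhs p∤rhs (trans (sym lhs≡) (trans eq rhs≡))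
      = c' , ∏b'≡ , trans ⟦b'⟧≡ (cong (λ x → p ^ (k + x) * ⟦ c' ⟧) (sym sj≡sj')) ,
        a₀ , a₀' , a₀≢0 , a₀'≢0 , cofactors≡
      where
      sj≡sj' : s j ≡ s j'
      sj≡sj' = residue-injective k (suc α) (suc α') (s<k j) (s<k j')
                 (trans (sym (shift α j)) (trans v≡v' (shift α' j')))

  ⟦⟧-cancel : ∀ {a a'} b b' → Squarefree (∏ K b) → Squarefree (∏ K b') → a ≢ 0 → a' ≢ 0 →
              a ^ k * ⟦ b ⟧ ≡ a' ^ k * ⟦ b' ⟧ → ⟦ b ⟧ ≡ ⟦ b' ⟧
  ⟦⟧-cancel b b' sq sq' a≢0 a'≢0 eq = cancel b b' sq sq' a≢0 a'≢0 eq (<-wellFounded (∏ K b))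
    where
    cancel : ∀ {a a'} b b' → Squarefree (∏ K b) → Squarefree (∏ K b') → a ≢ 0 → a' ≢ 0 →
             a ^ k * ⟦ b ⟧ ≡ a' ^ k * ⟦ b' ⟧ → Acc _<_ (∏ K b) → ⟦ b ⟧ ≡ ⟦ b' ⟧
    cancel b b' sq sq' a≢0 a'≢0 eq (acc rec) with ∏ K b ≟ 1
    ... | no ∏b≢1
      with p , p-prime , p∣∏b ← prime-factor _ (squarefree∧≢1⇒>1 sq ∏b≢1)
      with j , c , ∏b≡ , ⟦b⟧≡ ← prime∣∏-extract p-prime K b exponent p∣∏b
      with c' , ∏b'≡ , ⟦b'⟧≡ , _ , _ , a₀≢0 , a₀'≢0 , eq'
             ← prime-match p-prime sq sq' a≢0 a'≢0 eq ∏b≡ ⟦b⟧≡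
      = begin
        ⟦ b ⟧                   ≡⟨ ⟦b⟧≡ ⟩
        p ^ exponent j * ⟦ c ⟧  ≡⟨ cong (p ^ exponent j *_) (cancel c c' sqc sqc' a₀≢0 a₀'≢0 eq' (rec ∏c<∏b)) ⟩
        p ^ exponent j * ⟦ c' ⟧ ≡⟨ ⟦b'⟧≡ ⟨
        ⟦ b' ⟧                  ∎
      where
      open ≡-Reasoning
      sqc : Squarefree (∏ K c)
      sqc = squarefree-∣ (subst (∏ K c ∣_) (sym ∏b≡) (n∣m*n p)) sq
      sqc' : Squarefree (∏ K c')
      sqc' = squarefree-∣ (subst (∏ K c' ∣_) (sym ∏b'≡) (n∣m*n p)) sq'
      ∏c<∏b : ∏ K c < ∏ K b
      ∏c<∏b = subst (∏ K c <_) (sym (trans ∏b≡ (*-comm p (∏ K c))))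
                (m<m*n (∏ K c) p {{≢-nonZero (squarefree⇒≢0 sqc)}} (nonTrivial⇒n>1 p {{prime⇒nonTrivial p-prime}}))
    ... | yes ∏b≡1 with ∏ K b' ≟ 1
    ...   | yes ∏b'≡1 = trans (∏≡1⇒∏^≡1 K b exponent ∏b≡1) (sym (∏≡1⇒∏^≡1 K b' exponent ∏b'≡1))
    ...   | no ∏b'≢1
      with p , p-prime , p∣∏b' ← prime-factor _ (squarefree∧≢1⇒>1 sq' ∏b'≢1)
      with j , c' , ∏b'≡ , ⟦b'⟧≡ ← prime∣∏-extract p-prime K b' exponent p∣∏b'
      with c , ∏b≡ , _ ← prime-match p-prime sq' sq a'≢0 a≢0 (sym eq) ∏b'≡ ⟦b'⟧≡
      = ⊥-elim (prime∤1 p-prime (subst (p ∣_) (trans (sym ∏b≡) ∏b≡1) (m∣m*n (∏ K c))))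

-- Either 2 + n ≤ 2 (1 + a), and then 2 ^ k < L suffices; or (2 + n) a < n (1 + a).
n^k<a^kL⇒[2+n]^k<[1+a]^kL : ∀ k .{{_ : NonZero k}} {n a L} → 2 ^ k < L → n ^ k < a ^ k * L →
                             suc (suc n) ^ k < suc a ^ k * L
n^k<a^kL⇒[2+n]^k<[1+a]^kL k {n} {a} {L} 2^k<L n^k<a^kL with n ≤? 2 * a
... | yes n≤2a = begin-strict
  suc (suc n) ^ k    ≤⟨ ^-monoˡ-≤ k (subst (suc (suc n) ≤_) (sym (*-suc 2 a)) (s≤s (s≤s n≤2a))) ⟩
  (2 * suc a) ^ k    ≡⟨ ^-distribʳ-* 2 (suc a) k ⟩
  2 ^ k * suc a ^ k  <⟨ *-monoˡ-< (suc a ^ k) {{m^n≢0 (suc a) k}} 2^k<L ⟩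
  L * suc a ^ k      ≡⟨ *-comm L (suc a ^ k) ⟩
  suc a ^ k * L      ∎
  where open ≤-Reasoning
... | no n≰2a = *-cancelˡ-< (a ^ k) (suc (suc n) ^ k) (suc a ^ k * L) (begin-strict
  a ^ k * suc (suc n) ^ k    ≡⟨ *-comm (a ^ k) (suc (suc n) ^ k) ⟩
  suc (suc n) ^ k * a ^ k    ≡⟨ ^-distribʳ-* (suc (suc n)) a k ⟨
  (suc (suc n) * a) ^ k      <⟨ ^-monoˡ-< k [2+n]a<n[1+a] ⟩
  (n * suc a) ^ k            ≡⟨ ^-distribʳ-* n (suc a) k ⟩
  n ^ k * suc a ^ k          <⟨ *-monoˡ-< (suc a ^ k) {{m^n≢0 (suc a) k}} n^k<a^kL ⟩
  (a ^ k * L) * suc a ^ k    ≡⟨ *-assoc (a ^ k) L (suc a ^ k) ⟩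
  a ^ k * (L * suc a ^ k)    ≡⟨ cong (a ^ k *_) (*-comm L (suc a ^ k)) ⟩
  a ^ k * (suc a ^ k * L)    ∎)
  where
  open ≤-Reasoning
  [2+n]a<n[1+a] : suc (suc n) * a < n * suc a
  [2+n]a<n[1+a] = subst₂ _<_ (sym (*-distribʳ-+ a 2 n)) (sym (*-suc n a)) (+-monoˡ-< (n * a) (≰⇒> n≰2a))

-- Consecutive multiples a ^ k * L, (1 + a) ^ k * L are too far apart to share the window (n ^ k, (2 + n) ^ k).
window-multiple-unique : ∀ k .{{_ : NonZero k}} {n a a' L} → 2 ^ k < L →
  n ^ k < a ^ k * L → a ^ k * L < suc (suc n) ^ k → n ^ k < a' ^ k * L → a' ^ k * L < suc (suc n) ^ k → a ≡ a'
window-multiple-unique k {n} {a} {a'} {L} 2^k<L n<x x<n+2 n<y y<n+2 with <-cmp a a'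
... | tri≈ _ a≡a' _ = a≡a'
... | tri< a<a' _ _ = ⊥-elim (<-asym (n^k<a^kL⇒[2+n]^k<[1+a]^kL k 2^k<L n<x)
                                   (≤-<-trans (*-monoˡ-≤ L (^-monoˡ-≤ k a<a')) y<n+2))
... | tri> _ _ a'<a = ⊥-elim (<-asym (n^k<a^kL⇒[2+n]^k<[1+a]^kL k 2^k<L n<y)
                                   (≤-<-trans (*-monoˡ-≤ L (^-monoˡ-≤ k a'<a)) x<n+2))

suc[toℕ]<n : ∀ n (i : Fin (n ∸ 1)) → suc (toℕ i) < n
suc[toℕ]<n (suc n) i = s≤s (toℕ<n i)

module _ (k : ℕ) .{{_ : NonZero k}} where

  open KthPowerFreePart k (k ∸ 1) (λ i → suc (toℕ i)) (λ _ ()) (suc[toℕ]<n k)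

  Λ⇒2^k< : ∀ {L} → Λ k L → 2 ^ k < L
  Λ⇒2^k< (b , 1≤b , 2≤∏b , _ , refl) = begin-strict
    2 ^ k                 <⟨ ^-monoʳ-< 2 (s≤s (s≤s z≤n)) (n<1+n k) ⟩
    2 ^ suc k             ≤⟨ ^-monoˡ-≤ (suc k) 2≤∏b ⟩
    ∏ (k ∸ 1) b ^ suc k   ≤⟨ ∏^≤∏^ (k ∸ 1) b exponent (suc k) 1≤b 1+k≤exponent ⟩
    ⟦ b ⟧                 ∎
    where
    open ≤-Reasoning
    1+k≤exponent : ∀ i → suc k ≤ k + suc (toℕ i)
    1+k≤exponent i = ≤-trans (s≤s (m≤m+n k (toℕ i))) (≤-reflexive (sym (+-suc k (toℕ i))))

  Λ-injective : ∀ {L L' a a'} → Λ k L → Λ k L' → 1 ≤ a → 1 ≤ a' → a ^ k * L ≡ a' ^ k * L' → L ≡ L'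
  Λ-injective (b , _ , _ , sq , refl) (b' , _ , _ , sq' , refl) 1≤a 1≤a' =
    ⟦⟧-cancel b b' sq sq' (m<n⇒n≢0 1≤a) (m<n⇒n≢0 1≤a')

  -- c ^ k = c ^ k * ⟦ 1, …, 1 ⟧, and ⟦ 1, …, 1 ⟧ = 1 is too small to be in Λ k.
  Λ-not-kth-power : ∀ {L a c} → Λ k L → 1 ≤ a → 1 ≤ c → c ^ k ≢ a ^ k * L
  Λ-not-kth-power {a = a} {c} ΛL@(b , _ , _ , sq , refl) 1≤a 1≤c c^k≡a^kL =
    <-irrefl (sym ⟦b⟧≡1) (≤-<-trans (m^n>0 2 k) (Λ⇒2^k< ΛL))
    where
    ∏1≡1 : ∀ K → ∏ K (λ _ → 1) ≡ 1
    ∏1≡1 zero    = refl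
    ∏1≡1 (suc K) = cong (1 *_) (∏1≡1 K)
    ⟦1⟧≡1 : ⟦ (λ _ → 1) ⟧ ≡ 1
    ⟦1⟧≡1 = ∏≡1⇒∏^≡1 (k ∸ 1) (λ _ → 1) exponent (∏1≡1 (k ∸ 1))
    squarefree-1 : Squarefree 1
    squarefree-1 p p-prime p²∣1 = prime∤1 p-prime (∣-trans (m∣m*n p) p²∣1)
    ⟦b⟧≡1 : ⟦ b ⟧ ≡ 1
    ⟦b⟧≡1 = trans (⟦⟧-cancel b (λ _ → 1) sq (subst Squarefree (sym (∏1≡1 (k ∸ 1))) squarefree-1)
                     (m<n⇒n≢0 1≤a) (m<n⇒n≢0 1≤c)
                     (trans (sym c^k≡a^kL) (trans (sym (*-identityʳ (c ^ k))) (cong (c ^ k *_) (sym ⟦1⟧≡1)))))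
                  ⟦1⟧≡1

module _ {A : Set} where

  ∈-─⁺ : ∀ {x y} {xs : List A} (x∈xs : x ∈ xs) → y ∈ xs → y ≢ x → y ∈ xs ─ x∈xs
  ∈-─⁺ (here refl) (here y≡x) y≢x = ⊥-elim (y≢x y≡x)
  ∈-─⁺ (here refl) (there y∈) _   = y∈
  ∈-─⁺ (there x∈) (here y≡)  _   = here y≡
  ∈-─⁺ (there x∈) (there y∈) y≢x = there (∈-─⁺ x∈ y∈ y≢x)

  Unique∧⊆⇒length≤ : ∀ {xs ys : List A} → Unique xs → xs ⊆ ys → length xs ≤ length ys
  Unique∧⊆⇒length≤ {[]}     _              _     = z≤n
  Unique∧⊆⇒length≤ {x ∷ xs} {ys} (x∉xs ∷ u) xs⊆ys =
    subst (suc (length xs) ≤_) (sym (length-removeAt′ ys (index x∈ys)))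
      (s≤s (Unique∧⊆⇒length≤ u λ y∈xs →
              ∈-─⁺ x∈ys (xs⊆ys (there y∈xs)) λ y≡x → All.lookup x∉xs y∈xs (sym y≡x)))
    where
    x∈ys : x ∈ ys
    x∈ys = xs⊆ys (here refl)

  Unique∧⊆∧length≥⇒⊇ : DecidableEquality A → ∀ {xs ys : List A} →
                       Unique xs → xs ⊆ ys → length ys ≤ length xs → ys ⊆ xs
  Unique∧⊆∧length≥⇒⊇ _≟ᴬ_ {xs} {ys} u xs⊆ys |ys|≤|xs| {y} y∈ys with any? (y ≟ᴬ_) xs
  ... | yes y∈xs = y∈xs
  ... | no  y∉xs =
    ⊥-elim (<-irrefl refl (≤-trans (Unique∧⊆⇒length≤ (All.tabulate y≢ ∷ u) y∷xs⊆ys) |ys|≤|xs|))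
    where
    y≢ : ∀ {x} → x ∈ xs → y ≢ x
    y≢ x∈xs refl = y∉xs x∈xs
    y∷xs⊆ys : (y ∷ xs) ⊆ ys
    y∷xs⊆ys (here refl) = y∈ys
    y∷xs⊆ys (there x∈xs) = xs⊆ys x∈xs

  labels : ∀ {B : Set} {R : A → B → Set} (xs : List A) → Unique xs →
    (∀ {x} → x ∈ xs → ∃ (R x)) → (∀ {x x' y} → x ∈ xs → x' ∈ xs → R x y → R x' y → x ≡ x') →
    Σ (List B) λ ys → Unique ys × length ys ≡ length xs ×
      (∀ {y} → y ∈ ys → ∃ λ x → x ∈ xs × R x y) × (∀ {x} → x ∈ xs → ∃ λ y → y ∈ ys × R x y)
  labels []       _            _     _   = [] , [] , refl , (λ ()) , (λ ())
  labels {R = R} (x ∷ xs) (x∉xs ∷ u) label inj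
    with y , Rxy ← label (here refl)
       | ys , uy , |ys| , ys→xs , xs→ys ← labels xs u (label ∘ there) (λ x∈ x'∈ → inj (there x∈) (there x'∈))
    = y ∷ ys , All.tabulate y∉ys ∷ uy , cong suc |ys| , ys→xs' , xs→ys'
    where
    y∉ys : ∀ {y'} → y' ∈ ys → y ≢ y'
    y∉ys y'∈ys refl with x' , x'∈xs , Rx'y ← ys→xs y'∈ys =
      All.lookup x∉xs x'∈xs (inj (here refl) (there x'∈xs) Rxy Rx'y)
    ys→xs' : ∀ {y'} → y' ∈ y ∷ ys → ∃ λ x' → x' ∈ x ∷ xs × R x' y'
    ys→xs' (here refl) = x , here refl , Rxy
    ys→xs' (there y'∈ys) with x' , x'∈xs , Rx'y' ← ys→xs y'∈ys = x' , there x'∈xs , Rx'y'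
    xs→ys' : ∀ {x'} → x' ∈ x ∷ xs → ∃ λ y' → y' ∈ y ∷ ys × R x' y'
    xs→ys' (here refl) = y , here refl , Rxy
    xs→ys' (there x'∈xs) with y' , y'∈ys , Rx'y' ← xs→ys x'∈xs = y' , there y'∈ys , Rx'y'

HasCard-resp : ∀ {X Y : ℕ → Set} {c} → (∀ {x} → X x → Y x) → (∀ {x} → Y x → X x) →
               HasCard X c → HasCard Y c
HasCard-resp X⇒Y Y⇒X (xs , unique , |xs| , xs≈X) =
  xs , unique , |xs| , λ x → X⇒Y ∘ proj₁ (xs≈X x) , proj₂ (xs≈X x) ∘ Y⇒X

module Windows (k : ℕ) .{{_ : NonZero k}} where

  KthMultiple : ℕ → ℕ → Set
  KthMultiple L x = ∃ λ a → 1 ≤ a × x ≡ a ^ k * L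

  HitsIn : ℕ → ℕ → ℕ → Set
  HitsIn u v L = ∃ (Between u v (KthMultiple L))

  Occurring : ℕ → ℕ → List ℕ → Set
  Occurring u v T = All (Λ k) T × (∀ {L} → L ∈ T → HitsIn u v L) × (∀ {L} → Λ k L → HitsIn u v L → L ∈ T)

  occurring-unique : ∀ {u v T T'} → Occurring u v T → Occurring u v T' → SameSet T T'
  occurring-unique (allΛ , hits , complete) (allΛ' , hits' , complete') L =
    (λ L∈T → complete' (All.lookup allΛ L∈T) (hits L∈T)) ,
    (λ L∈T' → complete (All.lookup allΛ' L∈T') (hits' L∈T'))

  Sk⇒S-occurring : ∀ {u v T x} → Occurring u v T → Between u v (Sk k) x → Between u v (S k (Mem T)) x
  Sk⇒S-occurring (_ , _ , complete) (u<x , x<v , a , L , 1≤a , ΛL , x≡) =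
    u<x , x<v , a , L , 1≤a , complete ΛL (_ , u<x , x<v , a , 1≤a , x≡) , x≡

  S⇒Sk : ∀ {u v T x} → All (Λ k) T → Between u v (S k (Mem T)) x → Between u v (Sk k) x
  S⇒Sk allΛ (u<x , x<v , a , L , 1≤a , L∈T , x≡) = u<x , x<v , a , L , 1≤a , All.lookup allΛ L∈T , x≡

  kthMultiple-Λ-unique : ∀ {L L' x} → Λ k L → Λ k L' → KthMultiple L x → KthMultiple L' x → L ≡ L'
  kthMultiple-Λ-unique ΛL ΛL' (a , 1≤a , refl) (a' , 1≤a' , x≡) = Λ-injective k ΛL ΛL' 1≤a 1≤a' x≡

  module _ (n : ℕ) where

    SubWindow : ℕ → ℕ → Set
    SubWindow u v = n ^ k ≤ u × v ≤ suc (suc n) ^ k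

    InWindow : ℕ → Set
    InWindow x = n ^ k < x × x < suc (suc n) ^ k

    kthMultiple-unique : ∀ {L x y} → Λ k L → InWindow x → InWindow y →
                         KthMultiple L x → KthMultiple L y → x ≡ y
    kthMultiple-unique {L} ΛL (n<x , x<n+2) (n<y , y<n+2) (a , _ , refl) (a' , _ , refl) =
      cong (λ a → a ^ k * L) (window-multiple-unique k (Λ⇒2^k< k ΛL) n<x x<n+2 n<y y<n+2)

    widen : ∀ {u v x} → SubWindow u v → u < x → x < v → InWindow x
    widen (n≤u , v≤n+2) u<x x<v = ≤-<-trans n≤u u<x , <-≤-trans x<v v≤n+2

    occurring-of-card : ∀ {u v c} → SubWindow u v → HasCard (Between u v (Sk k)) c →
                        Σ (List ℕ) λ T → Unique T × length T ≡ c × Occurring u v T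
    occurring-of-card {u} {v} sub (xs , unique , |xs| , xs≈) with labels xs unique label inj
      where
      label : ∀ {x} → x ∈ xs → ∃ λ L → Λ k L × KthMultiple L x
      label {x} x∈xs with _ , _ , a , L , 1≤a , ΛL , x≡ ← proj₁ (xs≈ x) x∈xs = L , ΛL , a , 1≤a , x≡
      inj : ∀ {x x' L} → x ∈ xs → x' ∈ xs → Λ k L × KthMultiple L x → Λ k L × KthMultiple L x' → x ≡ x'
      inj {x} {x'} x∈ x'∈ (ΛL , x-mult) (_ , x'-mult)
        with u<x , x<v , _ ← proj₁ (xs≈ x) x∈ | u<x' , x'<v , _ ← proj₁ (xs≈ x') x'∈ =
        kthMultiple-unique ΛL (widen sub u<x x<v) (widen sub u<x' x'<v) x-mult x'-mult
    ... | ys , uy , |ys| , ys→xs , xs→ys = ys , uy , trans |ys| |xs| , All.tabulate Λ-of , hits , complete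
      where
      Λ-of : ∀ {L} → L ∈ ys → Λ k L
      Λ-of L∈ys with _ , _ , ΛL , _ ← ys→xs L∈ys = ΛL
      hits : ∀ {L} → L ∈ ys → HitsIn u v L
      hits L∈ys with x , x∈xs , _ , x-mult ← ys→xs L∈ys
        with u<x , x<v , _ ← proj₁ (xs≈ x) x∈xs = x , u<x , x<v , x-mult
      complete : ∀ {L} → Λ k L → HitsIn u v L → L ∈ ys
      complete ΛL (x , u<x , x<v , a , 1≤a , x≡)
        with L' , L'∈ys , ΛL' , x-mult' ← xs→ys (proj₂ (xs≈ x) (u<x , x<v , a , _ , 1≤a , ΛL , x≡)) =
        subst (_∈ ys) (sym (kthMultiple-Λ-unique ΛL ΛL' (a , 1≤a , x≡) x-mult')) L'∈ys

    hits-of-card : ∀ {u v T} → SubWindow u v → All (Λ k) T → HasCard (Between u v (S k (Mem T))) (length T) →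
                   ∀ {L} → L ∈ T → HitsIn u v L
    hits-of-card {u} {v} {T} sub allΛ (xs , unique , |xs| , xs≈) {L} L∈T with labels xs unique label inj
      where
      label : ∀ {x} → x ∈ xs → ∃ λ L → L ∈ T × KthMultiple L x
      label {x} x∈xs with _ , _ , a , L , 1≤a , L∈T , x≡ ← proj₁ (xs≈ x) x∈xs = L , L∈T , a , 1≤a , x≡
      inj : ∀ {x x' L} → x ∈ xs → x' ∈ xs → L ∈ T × KthMultiple L x → L ∈ T × KthMultiple L x' → x ≡ x'
      inj {x} {x'} x∈ x'∈ (L∈T , x-mult) (_ , x'-mult)
        with u<x , x<v , _ ← proj₁ (xs≈ x) x∈ | u<x' , x'<v , _ ← proj₁ (xs≈ x') x'∈ =
        kthMultiple-unique (All.lookup allΛ L∈T) (widen sub u<x x<v) (widen sub u<x' x'<v) x-mult x'-mult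
    ... | ys , uy , |ys| , ys→xs , _
      with ys→xs (T⊆ys L∈T)
      where
      ys⊆T : ys ⊆ T
      ys⊆T L∈ys with _ , _ , L∈T , _ ← ys→xs L∈ys = L∈T
      T⊆ys : T ⊆ ys
      T⊆ys = Unique∧⊆∧length≥⇒⊇ _≟_ uy ys⊆T (≤-reflexive (trans (sym |xs|) (sym |ys|)))
    ... | x , x∈xs , _ , x-mult with u<x , x<v , _ ← proj₁ (xs≈ x) x∈xs = x , u<x , x<v , x-mult

    W₁ : SubWindow (n ^ k) (suc n ^ k)
    W₁ = ≤-refl , <⇒≤ (^-monoˡ-< k (n<1+n (suc n)))

    W₂ : SubWindow (suc n ^ k) (suc (suc n) ^ k)
    W₂ = <⇒≤ (^-monoˡ-< k (n<1+n n)) , ≤-refl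

    hits-W₁∩W₂ : ∀ {L} → Λ k L → HitsIn (n ^ k) (suc n ^ k) L → HitsIn (suc n ^ k) (suc (suc n) ^ k) L → ⊥
    hits-W₁∩W₂ ΛL (x , n<x , x<n+1 , x-mult) (y , n+1<y , y<n+2 , y-mult) =
      <-irrefl (kthMultiple-unique ΛL (widen W₁ n<x x<n+1) (widen W₂ n+1<y y<n+2) x-mult y-mult)
               (<-trans x<n+1 n+1<y)

    occurring-of-cards : ∀ {u v u' v' T O} → SubWindow u v → SubWindow u' v' →
      (∀ {L} → Λ k L → HitsIn u v L → HitsIn u' v' L → ⊥) → All (Λ k) T → All (Λ k) O →
      HasCard (Between u v (S k (Mem T))) (length T) → HasCard (Between u' v' (S k (Mem O))) (length O) →
      (∀ {L} → Λ k L → HitsIn u v L → L ∈ T ⊎ L ∈ O) → Occurring u v T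
    occurring-of-cards {u} {v} {T = T} sub sub' disjoint allT allO cardT cardO covered =
      allT , hits-of-card sub allT cardT , complete
      where
      complete : ∀ {L} → Λ k L → HitsIn u v L → L ∈ T
      complete ΛL hit with covered ΛL hit
      ... | inj₁ L∈T = L∈T
      ... | inj₂ L∈O = ⊥-elim (disjoint ΛL hit (hits-of-card sub' allO cardO L∈O))

    B⇒covered : ∀ {I J L x} → B k I J n → Λ k L → InWindow x → KthMultiple L x → L ∈ I ⊎ L ∈ J
    B⇒covered {I} {J} {L} {x} (_ , _ , _ , no-rest) ΛL (n<x , x<n+2) (a , 1≤a , x≡) with L ∈? I | L ∈? J
    ... | yes L∈I | _        = inj₁ L∈I
    ... | no _    | yes L∈J  = inj₂ L∈J
    ... | no L∉I  | no L∉J   = ⊥-elim (no-rest x (n<x , x<n+2 , a , L , 1≤a , (ΛL , L∉I , L∉J) , x≡))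

    B⇒occurring : ∀ {I J} → All (Λ k) I → All (Λ k) J → B k I J n →
                  Occurring (n ^ k) (suc n ^ k) I × Occurring (suc n ^ k) (suc (suc n) ^ k) J
    B⇒occurring allI allJ b@(_ , cardI , cardJ , _) =
      occurring-of-cards W₁ W₂ hits-W₁∩W₂ allI allJ cardI cardJ
        (λ ΛL (x , u<x , x<v , x-mult) → B⇒covered b ΛL (widen W₁ u<x x<v) x-mult) ,
      occurring-of-cards W₂ W₁ (λ ΛL hit₂ hit₁ → hits-W₁∩W₂ ΛL hit₁ hit₂) allJ allI cardJ cardI
        (λ ΛL (x , u<x , x<v , x-mult) → swap (B⇒covered b ΛL (widen W₂ u<x x<v) x-mult))

    A⇒B : ∀ {ℓ m} → A k ℓ m n → ∃ λ I → ∃ λ J → Admissible k ℓ m I J × B k I J n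
    A⇒B (1≤n , card₁ , card₂)
      with I , uI , |I| , occ₁@(allI , hitsI , completeI) ← occurring-of-card W₁ card₁
         | J , uJ , |J| , occ₂@(allJ , hitsJ , completeJ) ← occurring-of-card W₂ card₂
      = I , J , ((uI , allI) , (uJ , allJ) , |I| , |J| , disjoint) ,
        (1≤n , HasCard-resp (Sk⇒S-occurring occ₁) (S⇒Sk allI) (subst (HasCard _) (sym |I|) card₁)
             , HasCard-resp (Sk⇒S-occurring occ₂) (S⇒Sk allJ) (subst (HasCard _) (sym |J|) card₂)
             , no-rest)
      where
      disjoint : ∀ L → L ∈ I → L ∉ J
      disjoint L L∈I L∈J = hits-W₁∩W₂ (All.lookup allI L∈I) (hitsI L∈I) (hitsJ L∈J)
      no-rest : ∀ x → ¬ Between (n ^ k) (suc (suc n) ^ k) (S k (Rest k I J)) x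
      no-rest x (n<x , x<n+2 , a , L , 1≤a , (ΛL , L∉I , L∉J) , x≡) with <-cmp x (suc n ^ k)
      ... | tri< x<n+1 _ _ = L∉I (completeI ΛL (x , n<x , x<n+1 , a , 1≤a , x≡))
      ... | tri≈ _ x≡n+1 _ = Λ-not-kth-power k ΛL 1≤a (s≤s z≤n) (trans (sym x≡n+1) x≡)
      ... | tri> _ _ n+1<x = L∉J (completeJ ΛL (x , n+1<x , x<n+2 , a , 1≤a , x≡))

    B⇒A : ∀ {ℓ m I J} → Admissible k ℓ m I J → B k I J n → A k ℓ m n
    B⇒A ((_ , allI) , (_ , allJ) , |I| , |J| , _) b@(1≤n , cardI , cardJ , _)
      with occ₁ , occ₂ ← B⇒occurring allI allJ b
      = 1≤n , subst (HasCard _) |I| (HasCard-resp (S⇒Sk allI) (Sk⇒S-occurring occ₁) cardI)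
            , subst (HasCard _) |J| (HasCard-resp (S⇒Sk allJ) (Sk⇒S-occurring occ₂) cardJ)

    B-unique : ∀ {ℓ m I J I' J'} → Admissible k ℓ m I J → Admissible k ℓ m I' J' → B k I J n → B k I' J' n →
               SameSet I I' × SameSet J J'
    B-unique ((_ , allI) , (_ , allJ) , _) ((_ , allI') , (_ , allJ') , _) b b'
      with occ₁ , occ₂ ← B⇒occurring allI allJ b | occ₁' , occ₂' ← B⇒occurring allI' allJ' b'
      = occurring-unique occ₁ occ₁' , occurring-unique occ₂ occ₂'

lemma4p1 : (k ℓ m : ℕ) → 2 ≤ k →
    ((n : ℕ) → A k ℓ m n ⇔ (∃ λ (I : List ℕ) → ∃ λ (J : List ℕ) → Admissible k ℓ m I J × B k I J n))
    × ((I J I' J' : List ℕ) (n : ℕ) → Admissible k ℓ m I J → Admissible k ℓ m I' J' →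
         B k I J n → B k I' J' n → SameSet I I' × SameSet J J')
lemma4p1 k ℓ m 2≤k =
  (λ n → mk⇔ (A⇒B n) (λ (_ , _ , adm , b) → B⇒A n adm b)) ,
  (λ _ _ _ _ n → B-unique n)
  where open Windows k {{>-nonZero (≤-trans (s≤s z≤n) 2≤k)}}
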